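{- Let $n$ be a number and $p\ge0$ an integer such that the ball $[n,-\frac{1}{2^p}]$ is balanced. Then for all integers $m\ge0$, $q\ge0$ and $a$ with either $a$ odd and $0<a<2^q$, or $a=0$, such that $m+a2^{ -q}>0$, \[[n,-\tfrac{1}{2^p}]\mathbin{:}\Big(m+\frac{a}{2^q}\Big)=n+\frac{1}{2^p}-\frac{1}{2^{p+m}}+\frac{a}{2^{p+m+q+1}},\] where $m+\frac{a}{2^q}$ denotes any game of that number value (e.g. its canonical form).
   Context: Games are short normal-play combinatorial games with the usual disjunctive sum, order and equality; numbers are games whose options are numbers with every Left option strictly less than every Right option, values identified with dyadic rationals. The ordinal sum is $G\mathbin{:}H\cong\{L(G),G\mathbin{:}H^L\mid R(G),G\mathbin{:}H^R\}$; its value depends only on the value of $H$ (Colon Principle) but on the literal form of $G$. For numbers $n,\Delta$, the ball $[n,\Delta]$ is the game $\{x\mid y\}$ where $x,y$ are the canonical forms of $n+\Delta$ and $n-\Delta$; it is balanced if $[n,\Delta]+[n,\Delta]=n+n$. -}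

module Defs where

open import Data.Bool using (Bool; true; false; _∧_; _∨_; not; T; if_then_else_)
open import Data.List using (List; []; _∷_; _++_)
open import Data.Nat as ℕ using (ℕ; zero; suc; _^_)
open import Data.Integer as ℤ using (ℤ; +_; -[1+_])
open import Data.Integer.DivMod using (_/ℕ_; _%ℕ_)
open import Data.Product using (_×_)

data Game : Set where
  ⟨_∣_⟩ : List Game → List Game → Game

leftOpts : Game → List Game
leftOpts ⟨ l ∣ r ⟩ = l

rightOpts : Game → List Game
rightOpts ⟨ l ∣ r ⟩ = r

mutual
  _≤ᵇ_ : Game → Game → Bool
  ⟨ gl ∣ gr ⟩ ≤ᵇ ⟨ hl ∣ hr ⟩ =
    not (someLeftGe ⟨ hl ∣ hr ⟩ gl) ∧ not (someRightLe hr ⟨ gl ∣ gr ⟩)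

  someLeftGe : Game → List Game → Bool
  someLeftGe H []       = false
  someLeftGe H (g ∷ gs) = (H ≤ᵇ g) ∨ someLeftGe H gs

  someRightLe : List Game → Game → Bool
  someRightLe []       G = false
  someRightLe (h ∷ hs) G = (h ≤ᵇ G) ∨ someRightLe hs G

infix 4 _≤_ _≈_

_≤_ : Game → Game → Set
G ≤ H = T (G ≤ᵇ H)

_≈_ : Game → Game → Set
G ≈ H = (G ≤ H) × (H ≤ G)

infixl 6 _⊕_

mutual
  _⊕_ : Game → Game → Game
  ⟨ gl ∣ gr ⟩ ⊕ ⟨ hl ∣ hr ⟩ =
    ⟨ addLeftList gl ⟨ hl ∣ hr ⟩ ++ addRightList ⟨ gl ∣ gr ⟩ hl
    ∣ addLeftList gr ⟨ hl ∣ hr ⟩ ++ addRightList ⟨ gl ∣ gr ⟩ hr ⟩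

  addLeftList : List Game → Game → List Game
  addLeftList []       H = []
  addLeftList (g ∷ gs) H = (g ⊕ H) ∷ addLeftList gs H

  addRightList : Game → List Game → List Game
  addRightList G []       = []
  addRightList G (h ∷ hs) = (G ⊕ h) ∷ addRightList G hs

-- Ordinal sum  G : H = { G^L, G : H^L | G^R, G : H^R }
-- (depends on the literal form of G).

mutual
  _∶_ : Game → Game → Game
  G ∶ ⟨ hl ∣ hr ⟩ = ⟨ leftOpts G ++ ordList G hl ∣ rightOpts G ++ ordList G hr ⟩

  ordList : Game → List Game → List Game
  ordList G []       = []
  ordList G (h ∷ hs) = (G ∶ h) ∷ ordList G hs

-- Dyadic rationals:  dy j e  denotes  j / 2^e.

record Dyadic : Set where
  constructor dy
  field
    num : ℤ
    exp : ℕ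

infixl 6 _+ᵈ_ _-ᵈ_

_+ᵈ_ : Dyadic → Dyadic → Dyadic
dy j e +ᵈ dy k f = dy (j ℤ.* (+ (2 ^ f)) ℤ.+ k ℤ.* (+ (2 ^ e))) (e ℕ.+ f)

-ᵈ_ : Dyadic → Dyadic
-ᵈ dy j e = dy (ℤ.- j) e

_-ᵈ_ : Dyadic → Dyadic → Dyadic
x -ᵈ y = x +ᵈ (-ᵈ y)

natGame : ℕ → Game
natGame zero    = ⟨ [] ∣ [] ⟩
natGame (suc k) = ⟨ natGame k ∷ [] ∣ [] ⟩

negNatGame : ℕ → Game
negNatGame zero    = ⟨ [] ∣ [] ⟩
negNatGame (suc k) = ⟨ [] ∣ negNatGame k ∷ [] ⟩

intGame : ℤ → Game
intGame (+ k)      = natGame k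
intGame -[1+ k ]   = negNatGame (suc k)

-- canonDy j e is the canonical form of j / 2^e:
--  e = 0 : integer canonical form;
--  j even: same number as (j/2) / 2^(e-1);
--  j odd, e ≥ 1 : { (j-1)/2^e | (j+1)/2^e }, both sides in canonical form.
canonDy : ℤ → ℕ → Game
canonDy j zero    = intGame j
canonDy j (suc e) with j %ℕ 2
... | zero = canonDy (j /ℕ 2) e
... | suc _ = ⟨ canonDy (j /ℕ 2) e ∷ [] ∣ canonDy ((j /ℕ 2) ℤ.+ + 1) e ∷ [] ⟩

canon : Dyadic → Game
canon (dy j e) = canonDy j e

ball : Dyadic → Dyadic → Game
ball n Δ = ⟨ canon (n +ᵈ Δ) ∷ [] ∣ canon (n -ᵈ Δ) ∷ [] ⟩

Balanced : Dyadic → Dyadic → Set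
Balanced n Δ = ball n Δ ⊕ ball n Δ ≈ canon n ⊕ canon n

inv2^ : ℕ → Dyadic
inv2^ p = dy (+ 1) p

-- A balanced ball B = {n - 2^-p | n + 2^-p} equals its centre n: if a right option r of n had
-- r ≤ B, then n + r ≤ r + r ≤ B + B ≤ n + n, so r ≤ n. The centre then has exponent at most p,
-- n = N/2^p, since an odd numerator at a finer level would give n a simpler left option inside the
-- ball. The ordinal sum B ∶ C with C ≥ 0 canonical is computed by induction on C: its options are
-- (N-1)/2^p, (N+1)/2^p and the B ∶ C^L, B ∶ C^R, and whenever C has options on a side they dominate
-- the option of B on that side. So B ∶ 0 = N/2^p, each integer step halves the distance to
-- (N+1)/2^p, and the binary digits of the fractional part of C refine the interval between the
-- values at consecutive integers by successive midpoints.
module Submission where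

open import Defs
open import Data.Nat using (ℕ; zero; suc; _^_; _%_; _+_; _*_; _<_)
open import Data.Integer using (+_)
open import Data.Sum using (_⊎_)
open import Data.Product using (_×_)
open import Relation.Binary.PropositionalEquality using (_≡_)

open import Data.Bool using (true; false; not; T)
open import Data.Bool.Properties using (T-∧; T-∨)
open import Data.Empty using (⊥-elim)
open import Data.Integer using (ℤ; -[1+_]; ∣_∣)
import Data.Integer as ℤ
open import Data.Integer.DivMod using (n%ℕd<d; a≡a%ℕn+[a/ℕn]*n)
import Data.Integer.Properties as ℤP
open import Data.Integer.Tactic.RingSolver using (solve-∀)
open import Data.List using (List; []; _∷_; _++_; map)
open import Data.List.Membership.Propositional using (_∈_; find)
open import Data.List.Membership.Propositional.Properties using (∈-++⁺ˡ; ∈-++⁺ʳ; ∈-++⁻; ∈-map⁺; ∈-map⁻)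
open import Data.List.Relation.Unary.All as All using (All; []; _∷_)
open import Data.List.Relation.Unary.Any using (Any; here; there)
import Data.Nat as ℕ
open import Data.Nat using (s≤s⁻¹)
open import Data.Nat.DivMod using (m/n≡1+[m∸n]/n)
open import Data.Nat.Properties
  using (≤-trans; <-≤-trans; ≰⇒>; <⇒≱; n<1+n; m≤m+n; m≤n⇒m≤o+n; m≤n⇒m≤n+o; m≤n⇒m<n∨m≡n; m^n>0;
         +-suc; +-comm; +-identityʳ; +-mono-≤; +-monoˡ-<; +-monoʳ-<; <-trans; +-commutativeSemigroup)
import Data.Nat.Tactic.RingSolver as ℕ-Solver
open import Data.Product using (_,_; proj₁; proj₂; ∃-syntax)
open import Data.Sum using (inj₁; inj₂)
open import Function.Bundles using (Equivalence)
open import Relation.Binary.Bundles using (Preorder; Setoid)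
import Relation.Binary.Reasoning.Preorder
import Relation.Binary.Reasoning.Setoid
open import Relation.Binary.PropositionalEquality using (refl; sym; trans; cong; cong₂; subst; subst₂; module ≡-Reasoning)
open import Relation.Nullary using (¬_)

-- T (G ≤ᵇ H) does not determine G and H; wrapping it in a record lets Agda infer them.
record _≲_ (G H : Game) : Set where
  constructor mk≲
  field ≲⇒≤ : G ≤ H

infix 4 _≲_ _≃_

_≃_ : Game → Game → Set
G ≃ H = G ≲ H × H ≲ G

≃⇒≈ : ∀ {G H} → G ≃ H → G ≈ H
≃⇒≈ (mk≲ p , mk≲ q) = p , q

≈⇒≃ : ∀ {G H} → G ≈ H → G ≃ H
≈⇒≃ (p , q) = mk≲ p , mk≲ q

infix 4 _⧏_

_⧏_ : Game → Game → Set
G ⧏ H = ¬ H ≲ G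

private
  T-not-intro : ∀ {b} → ¬ T b → T (not b)
  T-not-intro {false} _  = _
  T-not-intro {true}  ¬t = ¬t _

  T-not-elim : ∀ {b} → T (not b) → ¬ T b
  T-not-elim {false} _ ()

  someLeftGe-sound : ∀ H gs → T (someLeftGe H gs) → ∃[ g ] g ∈ gs × H ≲ g
  someLeftGe-sound H (g ∷ gs) t with Equivalence.to T-∨ t
  ... | inj₁ H≤g = g , here refl , mk≲ H≤g
  ... | inj₂ t′  = let g′ , g′∈gs , H≲g′ = someLeftGe-sound H gs t′ in g′ , there g′∈gs , H≲g′

  someLeftGe-complete : ∀ H {g gs} → g ∈ gs → H ≲ g → T (someLeftGe H gs)
  someLeftGe-complete H (here refl) (mk≲ H≤g) = Equivalence.from T-∨ (inj₁ H≤g)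
  someLeftGe-complete H (there g∈gs) H≲g    = Equivalence.from T-∨ (inj₂ (someLeftGe-complete H g∈gs H≲g))

  someRightLe-sound : ∀ hs G → T (someRightLe hs G) → ∃[ h ] h ∈ hs × h ≲ G
  someRightLe-sound (h ∷ hs) G t with Equivalence.to T-∨ t
  ... | inj₁ h≤G = h , here refl , mk≲ h≤G
  ... | inj₂ t′  = let h′ , h′∈hs , h′≲G = someRightLe-sound hs G t′ in h′ , there h′∈hs , h′≲G

  someRightLe-complete : ∀ G {h hs} → h ∈ hs → h ≲ G → T (someRightLe hs G)
  someRightLe-complete G (here refl) (mk≲ h≤G) = Equivalence.from T-∨ (inj₁ h≤G)
  someRightLe-complete G (there h∈hs) h≲G    = Equivalence.from T-∨ (inj₂ (someRightLe-complete G h∈hs h≲G))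

≲-intro : ∀ {G H} → (∀ {g} → g ∈ leftOpts G → g ⧏ H) → (∀ {h} → h ∈ rightOpts H → G ⧏ h) → G ≲ H
≲-intro {⟨ gl ∣ gr ⟩} {H@(⟨ hl ∣ hr ⟩)} left right = mk≲ (Equivalence.from T-∧
  ( T-not-intro (λ t → let _ , g∈gl , H≲g = someLeftGe-sound H gl t in left g∈gl H≲g)
  , T-not-intro (λ t → let _ , h∈hr , h≲G = someRightLe-sound hr _ t in right h∈hr h≲G)))

≲-elimᴸ : ∀ {G H g} → G ≲ H → g ∈ leftOpts G → g ⧏ H
≲-elimᴸ {⟨ gl ∣ gr ⟩} {H@(⟨ hl ∣ hr ⟩)} (mk≲ G≤H) g∈gl H≲g =
  T-not-elim (proj₁ (Equivalence.to T-∧ G≤H)) (someLeftGe-complete H g∈gl H≲g)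

≲-elimᴿ : ∀ {G H h} → G ≲ H → h ∈ rightOpts H → G ⧏ h
≲-elimᴿ {G@(⟨ gl ∣ gr ⟩)} {⟨ hl ∣ hr ⟩} (mk≲ G≤H) h∈hr h≲G =
  T-not-elim (proj₂ (Equivalence.to T-∧ G≤H)) (someRightLe-complete G h∈hr h≲G)

mutual
  ≲-refl : ∀ {G} → G ≲ G
  ≲-refl {⟨ gl ∣ gr ⟩} = ≲-intro (λ g∈ G≲g → ≲-elimᴸ G≲g g∈ (All.lookup (≲-refl-all gl) g∈))
                                 (λ h∈ h≲G → ≲-elimᴿ h≲G h∈ (All.lookup (≲-refl-all gr) h∈))

  ≲-refl-all : ∀ gs → All (λ g → g ≲ g) gs
  ≲-refl-all []       = []
  ≲-refl-all (g ∷ gs) = ≲-refl ∷ ≲-refl-all gs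

leftOption⧏ : ∀ {G g} → g ∈ leftOpts G → g ⧏ G
leftOption⧏ g∈ G≲g = ≲-elimᴸ G≲g g∈ ≲-refl

⧏rightOption : ∀ {G h} → h ∈ rightOpts G → G ⧏ h
⧏rightOption h∈ h≲G = ≲-elimᴿ h≲G h∈ ≲-refl

mutual
  size : Game → ℕ
  size ⟨ l ∣ r ⟩ = suc (sizes l + sizes r)

  sizes : List Game → ℕ
  sizes []       = 0
  sizes (g ∷ gs) = size g + sizes gs

private
  ∈⇒size≤sizes : ∀ {g gs} → g ∈ gs → size g ℕ.≤ sizes gs
  ∈⇒size≤sizes {gs = g ∷ gs} (here refl) = m≤m+n (size g) (sizes gs)
  ∈⇒size≤sizes {gs = h ∷ gs} (there g∈) = m≤n⇒m≤o+n (size h) (∈⇒size≤sizes g∈)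

size-leftOption : ∀ G {g} → g ∈ leftOpts G → size g < size G
size-leftOption ⟨ l ∣ r ⟩ g∈ = ℕ.s≤s (m≤n⇒m≤n+o (sizes r) (∈⇒size≤sizes g∈))

size-rightOption : ∀ G {h} → h ∈ rightOpts G → size h < size G
size-rightOption ⟨ l ∣ r ⟩ h∈ = ℕ.s≤s (m≤n⇒m≤o+n (sizes l) (∈⇒size≤sizes h∈))

-- The recursive calls below replace one game by one of its options and permute the games,
-- so they terminate by a fuel bound on the sum of the sizes.
private
  open import Algebra.Properties.CommutativeSemigroup +-commutativeSemigroup
    using (xy∙z≈xz∙y; xy∙z≈zx∙y; xy∙z≈yz∙x)

  x<a⇒x+b+c<a+b+c : ∀ b c {a x} → x < a → x + b + c < a + b + c
  x<a⇒x+b+c<a+b+c b c x<a = +-monoˡ-< c (+-monoˡ-< b x<a)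

  x<b⇒a+c+x<a+b+c : ∀ a c {b x} → x < b → a + c + x < a + b + c
  x<b⇒a+c+x<a+b+c a c {b} {x} x<b = subst (a + c + x <_) (xy∙z≈xz∙y a c b) (+-monoʳ-< (a + c) x<b)

  x<c⇒a+x+b<a+b+c : ∀ a b {c x} → x < c → a + x + b < a + b + c
  x<c⇒a+x+b<a+b+c a b {c} {x} x<c = subst (_< a + b + c) (sym (xy∙z≈xz∙y a x b)) (+-monoʳ-< (a + b) x<c)

  x<a⇒b+c+x<a+b+c : ∀ b c {a x} → x < a → b + c + x < a + b + c
  x<a⇒b+c+x<a+b+c b c {a} {x} x<a = subst (b + c + x <_) (xy∙z≈zx∙y b c a) (+-monoʳ-< (b + c) x<a)

  x<c⇒x+a+b<a+b+c : ∀ a b {c x} → x < c → x + a + b < a + b + c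
  x<c⇒x+a+b<a+b+c a b {c} {x} x<c = subst (_< a + b + c) (sym (xy∙z≈yz∙x x a b)) (+-monoʳ-< (a + b) x<c)

  x<a⇒b+x<a+b : ∀ {a b x} → x < a → b + x < a + b
  x<a⇒b+x<a+b {a} {b} {x} x<a = subst (b + x <_) (+-comm b a) (+-monoʳ-< b x<a)

  x<b⇒x+a<a+b : ∀ {a b x} → x < b → x + a < a + b
  x<b⇒x+a<a+b {a} {b} {x} x<b = subst (_< a + b) (+-comm a x) (+-monoʳ-< a x<b)

  m<n<1+o⇒m<o : ∀ {m n o} → m < n → n < suc o → m < o
  m<n<1+o⇒m<o m<n n<1+o = <-≤-trans m<n (s≤s⁻¹ n<1+o)

≲-trans-fuel : ∀ n {G H K} → size G + size H + size K < n → G ≲ H → H ≲ K → G ≲ K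
≲-trans-fuel zero ()
≲-trans-fuel (suc n) {G} {H} {K} μ<n G≲H H≲K = ≲-intro
  (λ g∈ K≲g → ≲-elimᴸ G≲H g∈ (≲-trans-fuel n (m<n<1+o⇒m<o (x<a⇒b+c+x<a+b+c (size H) (size K) (size-leftOption G g∈)) μ<n) H≲K K≲g))
  (λ k∈ k≲G → ≲-elimᴿ H≲K k∈ (≲-trans-fuel n (m<n<1+o⇒m<o (x<c⇒x+a+b<a+b+c (size G) (size H) (size-rightOption K k∈)) μ<n) k≲G G≲H))

≲-trans : ∀ {G H K} → G ≲ H → H ≲ K → G ≲ K
≲-trans = ≲-trans-fuel _ (n<1+n _)

≲-reflexive : ∀ {G H} → G ≡ H → G ≲ H
≲-reflexive refl = ≲-refl

≃-reflexive : ∀ {G H} → G ≡ H → G ≃ H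
≃-reflexive refl = ≲-refl , ≲-refl

≃-refl : ∀ {G} → G ≃ G
≃-refl = ≲-refl , ≲-refl

≃-sym : ∀ {G H} → G ≃ H → H ≃ G
≃-sym (G≲H , H≲G) = H≲G , G≲H

≃-trans : ∀ {G H K} → G ≃ H → H ≃ K → G ≃ K
≃-trans (G≲H , H≲G) (H≲K , K≲H) = ≲-trans G≲H H≲K , ≲-trans K≲H H≲G

≲-preorder : Preorder _ _ _
≲-preorder = record
  { Carrier = Game ; _≈_ = _≃_ ; _≲_ = _≲_
  ; isPreorder = record
    { isEquivalence = record { refl = ≃-refl ; sym = ≃-sym ; trans = ≃-trans }
    ; reflexive = proj₁
    ; trans = ≲-trans } }

module ≲-Reasoning = Relation.Binary.Reasoning.Preorder ≲-preorder

≃-setoid : Setoid _ _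
≃-setoid = record
  { Carrier = Game ; _≈_ = _≃_
  ; isEquivalence = record { refl = ≃-refl ; sym = ≃-sym ; trans = ≃-trans } }

module ≃-Reasoning = Relation.Binary.Reasoning.Setoid ≃-setoid

private
  addLeftList≡map : ∀ gs H → addLeftList gs H ≡ map (_⊕ H) gs
  addLeftList≡map []       H = refl
  addLeftList≡map (g ∷ gs) H = cong (g ⊕ H ∷_) (addLeftList≡map gs H)

  addRightList≡map : ∀ G hs → addRightList G hs ≡ map (G ⊕_) hs
  addRightList≡map G []       = refl
  addRightList≡map G (h ∷ hs) = cong (G ⊕ h ∷_) (addRightList≡map G hs)

  leftOpts-⊕ : ∀ G H → leftOpts (G ⊕ H) ≡ map (_⊕ H) (leftOpts G) ++ map (G ⊕_) (leftOpts H)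
  leftOpts-⊕ ⟨ gl ∣ gr ⟩ ⟨ hl ∣ hr ⟩ = cong₂ _++_ (addLeftList≡map gl _) (addRightList≡map _ hl)

  rightOpts-⊕ : ∀ G H → rightOpts (G ⊕ H) ≡ map (_⊕ H) (rightOpts G) ++ map (G ⊕_) (rightOpts H)
  rightOpts-⊕ ⟨ gl ∣ gr ⟩ ⟨ hl ∣ hr ⟩ = cong₂ _++_ (addLeftList≡map gr _) (addRightList≡map _ hr)

module SumOptions (opts : Game → List Game)
  (opts-⊕ : ∀ G H → opts (G ⊕ H) ≡ map (_⊕ H) (opts G) ++ map (G ⊕_) (opts H)) where

  ∈-⊕⁺ˡ : ∀ G H {g} → g ∈ opts G → g ⊕ H ∈ opts (G ⊕ H)
  ∈-⊕⁺ˡ G H g∈ = subst (_ ∈_) (sym (opts-⊕ G H)) (∈-++⁺ˡ (∈-map⁺ (_⊕ H) g∈))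

  ∈-⊕⁺ʳ : ∀ G H {h} → h ∈ opts H → G ⊕ h ∈ opts (G ⊕ H)
  ∈-⊕⁺ʳ G H h∈ = subst (_ ∈_) (sym (opts-⊕ G H)) (∈-++⁺ʳ (map (_⊕ H) (opts G)) (∈-map⁺ (G ⊕_) h∈))

  ∈-⊕⁻ : ∀ G H {x} → x ∈ opts (G ⊕ H) →
         (∃[ g ] g ∈ opts G × x ≡ g ⊕ H) ⊎ (∃[ h ] h ∈ opts H × x ≡ G ⊕ h)
  ∈-⊕⁻ G H x∈ with ∈-++⁻ (map (_⊕ H) (opts G)) (subst (_ ∈_) (opts-⊕ G H) x∈)
  ... | inj₁ x∈ˡ = inj₁ (∈-map⁻ (_⊕ H) x∈ˡ)
  ... | inj₂ x∈ʳ = inj₂ (∈-map⁻ (G ⊕_) x∈ʳ)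

open SumOptions leftOpts leftOpts-⊕ public
  renaming (∈-⊕⁺ˡ to ∈ᴸ-⊕⁺ˡ; ∈-⊕⁺ʳ to ∈ᴸ-⊕⁺ʳ; ∈-⊕⁻ to ∈ᴸ-⊕⁻)
open SumOptions rightOpts rightOpts-⊕ public
  renaming (∈-⊕⁺ˡ to ∈ᴿ-⊕⁺ˡ; ∈-⊕⁺ʳ to ∈ᴿ-⊕⁺ʳ; ∈-⊕⁻ to ∈ᴿ-⊕⁻)

mutual
  ⊕-monoʳ-fuel : ∀ n {K G H} → size K + size G + size H < n → G ≲ H → K ⊕ G ≲ K ⊕ H
  ⊕-monoʳ-fuel zero ()
  ⊕-monoʳ-fuel (suc n) {K} {G} {H} μ<n G≲H = ≲-intro left right
    where
    left : ∀ {x} → x ∈ leftOpts (K ⊕ G) → x ⧏ K ⊕ H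
    left x∈ with ∈ᴸ-⊕⁻ K G x∈
    ... | inj₁ (k , k∈ , refl) = λ K⊕H≲k⊕G → leftOption⧏ (∈ᴸ-⊕⁺ˡ K H k∈)
            (≲-trans K⊕H≲k⊕G (⊕-monoʳ-fuel n (m<n<1+o⇒m<o (x<a⇒x+b+c<a+b+c (size G) (size H) (size-leftOption K k∈)) μ<n) G≲H))
    ... | inj₂ (g , g∈ , refl) = λ K⊕H≲K⊕g → ≲-elimᴸ G≲H g∈
            (⊕-cancelˡ-fuel n (m<n<1+o⇒m<o (x<b⇒a+c+x<a+b+c (size K) (size H) (size-leftOption G g∈)) μ<n) K⊕H≲K⊕g)
    right : ∀ {y} → y ∈ rightOpts (K ⊕ H) → K ⊕ G ⧏ y
    right y∈ with ∈ᴿ-⊕⁻ K H y∈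
    ... | inj₁ (k , k∈ , refl) = λ k⊕H≲K⊕G → ⧏rightOption (∈ᴿ-⊕⁺ˡ K G k∈)
            (≲-trans (⊕-monoʳ-fuel n (m<n<1+o⇒m<o (x<a⇒x+b+c<a+b+c (size G) (size H) (size-rightOption K k∈)) μ<n) G≲H) k⊕H≲K⊕G)
    ... | inj₂ (h , h∈ , refl) = λ K⊕h≲K⊕G → ≲-elimᴿ G≲H h∈
            (⊕-cancelˡ-fuel n (m<n<1+o⇒m<o (x<c⇒a+x+b<a+b+c (size K) (size G) (size-rightOption H h∈)) μ<n) K⊕h≲K⊕G)

  ⊕-cancelˡ-fuel : ∀ n {K G H} → size K + size G + size H < n → K ⊕ G ≲ K ⊕ H → G ≲ H
  ⊕-cancelˡ-fuel zero ()
  ⊕-cancelˡ-fuel (suc n) {K} {G} {H} μ<n K⊕G≲K⊕H = ≲-intro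
    (λ g∈ H≲g → ≲-elimᴸ K⊕G≲K⊕H (∈ᴸ-⊕⁺ʳ K G g∈)
                  (⊕-monoʳ-fuel n (m<n<1+o⇒m<o (x<b⇒a+c+x<a+b+c (size K) (size H) (size-leftOption G g∈)) μ<n) H≲g))
    (λ h∈ h≲G → ≲-elimᴿ K⊕G≲K⊕H (∈ᴿ-⊕⁺ʳ K H h∈)
                  (⊕-monoʳ-fuel n (m<n<1+o⇒m<o (x<c⇒a+x+b<a+b+c (size K) (size G) (size-rightOption H h∈)) μ<n) h≲G))

⊕-monoʳ-≲ : ∀ K {G H} → G ≲ H → K ⊕ G ≲ K ⊕ H
⊕-monoʳ-≲ K = ⊕-monoʳ-fuel _ (n<1+n _)

⊕-cancelˡ-≲ : ∀ K {G H} → K ⊕ G ≲ K ⊕ H → G ≲ H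
⊕-cancelˡ-≲ K = ⊕-cancelˡ-fuel _ (n<1+n _)

⊕-comm-fuel : ∀ n {G H} → size G + size H < n → G ⊕ H ≲ H ⊕ G
⊕-comm-fuel zero ()
⊕-comm-fuel (suc n) {G} {H} μ<n = ≲-intro left right
  where
  swapˡ : ∀ {g} → size g < size G → g ⊕ H ≲ H ⊕ g
  swapˡ g<G = ⊕-comm-fuel n (m<n<1+o⇒m<o (+-monoˡ-< (size H) g<G) μ<n)
  swapʳ : ∀ {h} → size h < size H → G ⊕ h ≲ h ⊕ G
  swapʳ h<H = ⊕-comm-fuel n (m<n<1+o⇒m<o (+-monoʳ-< (size G) h<H) μ<n)
  left : ∀ {x} → x ∈ leftOpts (G ⊕ H) → x ⧏ H ⊕ G
  left x∈ with ∈ᴸ-⊕⁻ G H x∈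
  ... | inj₁ (g , g∈ , refl) = λ H⊕G≲g⊕H →
        leftOption⧏ (∈ᴸ-⊕⁺ʳ H G g∈) (≲-trans H⊕G≲g⊕H (swapˡ (size-leftOption G g∈)))
  ... | inj₂ (h , h∈ , refl) = λ H⊕G≲G⊕h →
        leftOption⧏ (∈ᴸ-⊕⁺ˡ H G h∈) (≲-trans H⊕G≲G⊕h (swapʳ (size-leftOption H h∈)))
  right : ∀ {y} → y ∈ rightOpts (H ⊕ G) → G ⊕ H ⧏ y
  right y∈ with ∈ᴿ-⊕⁻ H G y∈
  ... | inj₁ (h , h∈ , refl) = λ h⊕G≲G⊕H →
        ⧏rightOption (∈ᴿ-⊕⁺ʳ G H h∈) (≲-trans (swapʳ (size-rightOption H h∈)) h⊕G≲G⊕H)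
  ... | inj₂ (g , g∈ , refl) = λ H⊕g≲G⊕H →
        ⧏rightOption (∈ᴿ-⊕⁺ˡ G H g∈) (≲-trans (swapˡ (size-rightOption G g∈)) H⊕g≲G⊕H)

⊕-comm : ∀ G H → G ⊕ H ≲ H ⊕ G
⊕-comm G H = ⊕-comm-fuel _ (n<1+n _)

⊕-monoˡ-≲ : ∀ K {G H} → G ≲ H → G ⊕ K ≲ H ⊕ K
⊕-monoˡ-≲ K {G} {H} G≲H = begin
  G ⊕ K  ≲⟨ ⊕-comm G K ⟩
  K ⊕ G  ≲⟨ ⊕-monoʳ-≲ K G≲H ⟩
  K ⊕ H  ≲⟨ ⊕-comm K H ⟩
  H ⊕ K  ∎
  where open ≲-Reasoning

private
  ordList≡map : ∀ G hs → ordList G hs ≡ map (G ∶_) hs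
  ordList≡map G []       = refl
  ordList≡map G (h ∷ hs) = cong (G ∶ h ∷_) (ordList≡map G hs)

  leftOpts-∶ : ∀ G H → leftOpts (G ∶ H) ≡ leftOpts G ++ map (G ∶_) (leftOpts H)
  leftOpts-∶ G ⟨ hl ∣ hr ⟩ = cong (leftOpts G ++_) (ordList≡map G hl)

  rightOpts-∶ : ∀ G H → rightOpts (G ∶ H) ≡ rightOpts G ++ map (G ∶_) (rightOpts H)
  rightOpts-∶ G ⟨ hl ∣ hr ⟩ = cong (rightOpts G ++_) (ordList≡map G hr)

module OrdinalSumOptions (opts : Game → List Game)
  (opts-∶ : ∀ G H → opts (G ∶ H) ≡ opts G ++ map (G ∶_) (opts H)) where

  ∈-∶⁺ᴳ : ∀ G H {g} → g ∈ opts G → g ∈ opts (G ∶ H)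
  ∈-∶⁺ᴳ G H g∈ = subst (_ ∈_) (sym (opts-∶ G H)) (∈-++⁺ˡ g∈)

  ∈-∶⁺ᴴ : ∀ G H {h} → h ∈ opts H → G ∶ h ∈ opts (G ∶ H)
  ∈-∶⁺ᴴ G H h∈ = subst (_ ∈_) (sym (opts-∶ G H)) (∈-++⁺ʳ (opts G) (∈-map⁺ (G ∶_) h∈))

  ∈-∶⁻ : ∀ G H {x} → x ∈ opts (G ∶ H) → x ∈ opts G ⊎ (∃[ h ] h ∈ opts H × x ≡ G ∶ h)
  ∈-∶⁻ G H x∈ with ∈-++⁻ (opts G) (subst (_ ∈_) (opts-∶ G H) x∈)
  ... | inj₁ x∈ᴳ = inj₁ x∈ᴳ
  ... | inj₂ x∈ᴴ = inj₂ (∈-map⁻ (G ∶_) x∈ᴴ)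

open OrdinalSumOptions leftOpts leftOpts-∶ public
  renaming (∈-∶⁺ᴳ to ∈ᴸ-∶⁺ᴳ; ∈-∶⁺ᴴ to ∈ᴸ-∶⁺ᴴ; ∈-∶⁻ to ∈ᴸ-∶⁻)
open OrdinalSumOptions rightOpts rightOpts-∶ public
  renaming (∈-∶⁺ᴳ to ∈ᴿ-∶⁺ᴳ; ∈-∶⁺ᴴ to ∈ᴿ-∶⁺ᴴ; ∈-∶⁻ to ∈ᴿ-∶⁻)

mutual
  ∶-monoʳ-fuel : ∀ n G {H H′} → size H + size H′ < n → H ≲ H′ → G ∶ H ≲ G ∶ H′
  ∶-monoʳ-fuel zero G ()
  ∶-monoʳ-fuel (suc n) G {H} {H′} μ<n H≲H′ = ≲-intro left right
    where
    left : ∀ {x} → x ∈ leftOpts (G ∶ H) → x ⧏ G ∶ H′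
    left x∈ with ∈ᴸ-∶⁻ G H x∈
    ... | inj₁ x∈ᴳ = leftOption⧏ (∈ᴸ-∶⁺ᴳ G H′ x∈ᴳ)
    ... | inj₂ (h , h∈ , refl) = λ G∶H′≲G∶h → ≲-elimᴸ H≲H′ h∈
            (∶-cancelˡ-fuel n G (m<n<1+o⇒m<o (x<a⇒b+x<a+b (size-leftOption H h∈)) μ<n) G∶H′≲G∶h)
    right : ∀ {y} → y ∈ rightOpts (G ∶ H′) → G ∶ H ⧏ y
    right y∈ with ∈ᴿ-∶⁻ G H′ y∈
    ... | inj₁ y∈ᴳ = ⧏rightOption (∈ᴿ-∶⁺ᴳ G H y∈ᴳ)
    ... | inj₂ (h′ , h′∈ , refl) = λ G∶h′≲G∶H → ≲-elimᴿ H≲H′ h′∈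
            (∶-cancelˡ-fuel n G (m<n<1+o⇒m<o (x<b⇒x+a<a+b (size-rightOption H′ h′∈)) μ<n) G∶h′≲G∶H)

  ∶-cancelˡ-fuel : ∀ n G {H H′} → size H + size H′ < n → G ∶ H ≲ G ∶ H′ → H ≲ H′
  ∶-cancelˡ-fuel zero G ()
  ∶-cancelˡ-fuel (suc n) G {H} {H′} μ<n G∶H≲G∶H′ = ≲-intro
    (λ h∈ H′≲h → ≲-elimᴸ G∶H≲G∶H′ (∈ᴸ-∶⁺ᴴ G H h∈)
                   (∶-monoʳ-fuel n G (m<n<1+o⇒m<o (x<a⇒b+x<a+b (size-leftOption H h∈)) μ<n) H′≲h))
    (λ h′∈ h′≲H → ≲-elimᴿ G∶H≲G∶H′ (∈ᴿ-∶⁺ᴴ G H′ h′∈)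
                    (∶-monoʳ-fuel n G (m<n<1+o⇒m<o (x<b⇒x+a<a+b (size-rightOption H′ h′∈)) μ<n) h′≲H))

∶-congʳ : ∀ G {H H′} → H ≃ H′ → G ∶ H ≃ G ∶ H′
∶-congʳ G (H≲H′ , H′≲H) = ∶-monoʳ-fuel _ G (n<1+n _) H≲H′ , ∶-monoʳ-fuel _ G (n<1+n _) H′≲H

∶-monoʳ-≲ : ∀ G {H H′} → H ≲ H′ → G ∶ H ≲ G ∶ H′
∶-monoʳ-≲ G = ∶-monoʳ-fuel _ G (n<1+n _)

record NumberLike (X : Game) : Set where
  field
    leftOption-≲  : ∀ {x} → x ∈ leftOpts X → x ≲ X
    ≲-rightOption : ∀ {x} → x ∈ rightOpts X → X ≲ x
open NumberLike

balanced⇒≃ : ∀ {B X} → NumberLike X →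
  (∀ {b} → b ∈ leftOpts B → b ⧏ X) → (∀ {b} → b ∈ rightOpts B → X ⧏ b) →
  B ⊕ B ≃ X ⊕ X → B ≃ X
balanced⇒≃ {B} {X} X-num Bᴸ⧏X X⧏Bᴿ (B⊕B≲X⊕X , X⊕X≲B⊕B) =
  ≲-intro Bᴸ⧏X (λ {x} x∈ x≲B → ⧏rightOption x∈ (⊕-cancelˡ-≲ X (begin
    X ⊕ x  ≲⟨ ⊕-monoˡ-≲ x (≲-rightOption X-num x∈) ⟩
    x ⊕ x  ≲⟨ ⊕-monoˡ-≲ x x≲B ⟩
    B ⊕ x  ≲⟨ ⊕-monoʳ-≲ B x≲B ⟩
    B ⊕ B  ≲⟨ B⊕B≲X⊕X ⟩
    X ⊕ X  ∎))) ,
  ≲-intro (λ {x} x∈ B≲x → leftOption⧏ x∈ (⊕-cancelˡ-≲ X (begin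
    X ⊕ X  ≲⟨ X⊕X≲B⊕B ⟩
    B ⊕ B  ≲⟨ ⊕-monoʳ-≲ B B≲x ⟩
    B ⊕ x  ≲⟨ ⊕-monoˡ-≲ x B≲x ⟩
    x ⊕ x  ≲⟨ ⊕-monoˡ-≲ x (leftOption-≲ X-num x∈) ⟩
    X ⊕ x  ∎))) X⧏Bᴿ
  where open ≲-Reasoning

soleLeftOption-≲ : ∀ {A cs} → NumberLike A → All (A ⧏_) cs → A ≲ ⟨ A ∷ [] ∣ cs ⟩
soleLeftOption-≲ A-num A⧏cs = ≲-intro
  (λ a∈ G≲a → leftOption⧏ (here refl) (≲-trans G≲a (leftOption-≲ A-num a∈)))
  (All.lookup A⧏cs)

≲-soleRightOption : ∀ {C as} → NumberLike C → All (_⧏ C) as → ⟨ as ∣ C ∷ [] ⟩ ≲ C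
≲-soleRightOption C-num as⧏C = ≲-intro (All.lookup as⧏C)
  (λ c∈ c≲G → ⧏rightOption (here refl) (≲-trans (≲-rightOption C-num c∈) c≲G))

≃-extremalOptions : ∀ {ls rs a b} → All (_≲ a) ls → Any (a ≲_) ls → All (b ≲_) rs → Any (_≲ b) rs →
                    ⟨ ls ∣ rs ⟩ ≃ ⟨ a ∷ [] ∣ b ∷ [] ⟩
≃-extremalOptions ls≲a a≲some b≲rs some≲b with find a≲some | find some≲b
... | l , l∈ , a≲l | r , r∈ , r≲b =
  ≲-intro (λ l∈ls G≲l → leftOption⧏ (here refl) (≲-trans G≲l (All.lookup ls≲a l∈ls)))
          (λ { (here refl) b≲G → ⧏rightOption r∈ (≲-trans r≲b b≲G) }) ,
  ≲-intro (λ { (here refl) G≲a → leftOption⧏ l∈ (≲-trans G≲a a≲l) })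
          (λ r∈rs r≲G → ⧏rightOption (here refl) (≲-trans (All.lookup b≲rs r∈rs) r≲G))

private
  even-%2 : ∀ k → (k + k) ℕ.% 2 ≡ 0
  even-%2 zero    = refl
  even-%2 (suc k) rewrite +-suc k k = even-%2 k

  odd-%2 : ∀ k → suc (k + k) ℕ.% 2 ≡ 1
  odd-%2 zero    = refl
  odd-%2 (suc k) rewrite +-suc k k = odd-%2 k

  2+n/2 : ∀ n → suc (suc n) ℕ./ 2 ≡ suc (n ℕ./ 2)
  2+n/2 n = m/n≡1+[m∸n]/n {suc (suc n)} (ℕ.s≤s (ℕ.s≤s ℕ.z≤n))

  even-/2 : ∀ k → (k + k) ℕ./ 2 ≡ k
  even-/2 zero    = refl
  even-/2 (suc k) rewrite +-suc k k = trans (2+n/2 (k + k)) (cong suc (even-/2 k))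

  odd-/2 : ∀ k → suc (k + k) ℕ./ 2 ≡ k
  odd-/2 zero    = refl
  odd-/2 (suc k) rewrite +-suc k k = trans (2+n/2 (suc (k + k))) (cong suc (odd-/2 k))

  ℤ-even-%2 : ∀ z → (z ℤ.+ z) ℤ.%ℕ 2 ≡ 0
  ℤ-even-%2 (+ k)    = even-%2 k
  ℤ-even-%2 -[1+ k ] rewrite even-%2 k = refl

  ℤ-even-/2 : ∀ z → (z ℤ.+ z) ℤ./ℕ 2 ≡ z
  ℤ-even-/2 (+ k)    = cong +_ (even-/2 k)
  ℤ-even-/2 -[1+ k ] rewrite even-%2 k | 2+n/2 (k + k) | even-/2 k = refl

  ℤ-odd-%2 : ∀ z → (z ℤ.+ z ℤ.+ + 1) ℤ.%ℕ 2 ≡ 1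
  ℤ-odd-%2 (+ k)    rewrite +-comm (k + k) 1 = odd-%2 k
  ℤ-odd-%2 -[1+ k ] rewrite odd-%2 k = refl

  ℤ-odd-/2 : ∀ z → (z ℤ.+ z ℤ.+ + 1) ℤ./ℕ 2 ≡ z
  ℤ-odd-/2 (+ k)    rewrite +-comm (k + k) 1 = cong +_ (odd-/2 k)
  ℤ-odd-/2 -[1+ k ] rewrite odd-%2 k | odd-/2 k = refl

canonDy-even : ∀ z K → canonDy (z ℤ.+ z) (suc K) ≡ canonDy z K
canonDy-even z K rewrite ℤ-even-%2 z | ℤ-even-/2 z = refl

canonDy-odd : ∀ z K → canonDy (z ℤ.+ z ℤ.+ + 1) (suc K) ≡ ⟨ canonDy z K ∷ [] ∣ canonDy (z ℤ.+ + 1) K ∷ [] ⟩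
canonDy-odd z K rewrite ℤ-odd-%2 z | ℤ-odd-/2 z = refl

data Parity : ℤ → Set where
  even : ∀ z → Parity (z ℤ.+ z)
  odd  : ∀ z → Parity (z ℤ.+ z ℤ.+ + 1)

parity : ∀ x → Parity x
parity x = classify (x ℤ.%ℕ 2) (n%ℕd<d x 2) (a≡a%ℕn+[a/ℕn]*n x 2)
  where
  classify : ∀ r → r < 2 → x ≡ + r ℤ.+ (x ℤ./ℕ 2) ℤ.* + 2 → Parity x
  classify 0 _ x≡ = subst Parity (sym (trans x≡ (lemma (x ℤ./ℕ 2)))) (even (x ℤ./ℕ 2))
    where lemma : ∀ z → + 0 ℤ.+ z ℤ.* + 2 ≡ z ℤ.+ z
          lemma = solve-∀
  classify 1 _ x≡ = subst Parity (sym (trans x≡ (lemma (x ℤ./ℕ 2)))) (odd (x ℤ./ℕ 2))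
    where lemma : ∀ z → + 1 ℤ.+ z ℤ.* + 2 ≡ z ℤ.+ z ℤ.+ + 1
          lemma = solve-∀
  classify (suc (suc _)) (ℕ.s≤s (ℕ.s≤s ())) _

private
  z+z+1+1 : ∀ z → z ℤ.+ z ℤ.+ + 1 ℤ.+ + 1 ≡ (z ℤ.+ + 1) ℤ.+ (z ℤ.+ + 1)
  z+z+1+1 = solve-∀

canonDy-⧏suc : ∀ K x → canonDy x K ⧏ canonDy (x ℤ.+ + 1) K
canonDy-⧏suc zero (+ k) rewrite +-comm k 1 = leftOption⧏ (here refl)
canonDy-⧏suc zero -[1+ zero ]  = ⧏rightOption (here refl)
canonDy-⧏suc zero -[1+ suc k ] = ⧏rightOption (here refl)
canonDy-⧏suc (suc K) x with parity x
... | even z rewrite canonDy-even z K | canonDy-odd z K = leftOption⧏ (here refl)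
... | odd z rewrite z+z+1+1 z | canonDy-even (z ℤ.+ + 1) K | canonDy-odd z K = ⧏rightOption (here refl)

natGame-numberLike : ∀ k → NumberLike (natGame k)
natGame-numberLike zero    = record { leftOption-≲ = λ () ; ≲-rightOption = λ () }
natGame-numberLike (suc k) = record
  { leftOption-≲  = λ { (here refl) → soleLeftOption-≲ (natGame-numberLike k) [] }
  ; ≲-rightOption = λ () }

negNatGame-numberLike : ∀ k → NumberLike (negNatGame k)
negNatGame-numberLike zero    = record { leftOption-≲ = λ () ; ≲-rightOption = λ () }
negNatGame-numberLike (suc k) = record
  { leftOption-≲  = λ ()
  ; ≲-rightOption = λ { (here refl) → ≲-soleRightOption (negNatGame-numberLike k) [] } }

canonDy-numberLike : ∀ K x → NumberLike (canonDy x K)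
canonDy-numberLike zero (+ k)    = natGame-numberLike k
canonDy-numberLike zero -[1+ k ] = negNatGame-numberLike (suc k)
canonDy-numberLike (suc K) x with parity x
... | even z rewrite canonDy-even z K = canonDy-numberLike K z
... | odd z rewrite canonDy-odd z K = record
  { leftOption-≲  = λ { (here refl) → soleLeftOption-≲ (canonDy-numberLike K z) (canonDy-⧏suc K z ∷ []) }
  ; ≲-rightOption = λ { (here refl) → ≲-soleRightOption (canonDy-numberLike K (z ℤ.+ + 1)) (canonDy-⧏suc K z ∷ []) } }

canonDy-≲suc : ∀ K x → canonDy x K ≲ canonDy (x ℤ.+ + 1) K
canonDy-≲suc zero (+ k) rewrite +-comm k 1 = soleLeftOption-≲ (natGame-numberLike k) []
canonDy-≲suc zero -[1+ zero ]  = ≲-soleRightOption (natGame-numberLike 0) []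
canonDy-≲suc zero -[1+ suc k ] = ≲-soleRightOption (negNatGame-numberLike (suc k)) []
canonDy-≲suc (suc K) x with parity x
... | even z rewrite canonDy-even z K | canonDy-odd z K =
  soleLeftOption-≲ (canonDy-numberLike K z) (canonDy-⧏suc K z ∷ [])
... | odd z rewrite z+z+1+1 z | canonDy-even (z ℤ.+ + 1) K | canonDy-odd z K =
  ≲-soleRightOption (canonDy-numberLike K (z ℤ.+ + 1)) (canonDy-⧏suc K z ∷ [])

canonDy-mono-≲ : ∀ K {x y} → x ℤ.≤ y → canonDy x K ≲ canonDy y K
canonDy-mono-≲ K {x} {y} x≤y = subst (λ y → canonDy x K ≲ canonDy y K) x+[y-x]≡y (≲+ ∣ y ℤ.- x ∣)
  where
  ≲+ : ∀ d → canonDy x K ≲ canonDy (x ℤ.+ + d) K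
  ≲+ zero    rewrite ℤP.+-identityʳ x = ≲-refl
  ≲+ (suc d) = ≲-trans (≲+ d) (subst (λ y → canonDy (x ℤ.+ + d) K ≲ canonDy y K)
                                     (lemma x (+ d)) (canonDy-≲suc K (x ℤ.+ + d)))
    where lemma : ∀ x y → x ℤ.+ y ℤ.+ + 1 ≡ x ℤ.+ (+ 1 ℤ.+ y)
          lemma = solve-∀
  x+[y-x]≡y : x ℤ.+ + ∣ y ℤ.- x ∣ ≡ y
  x+[y-x]≡y rewrite ℤP.0≤i⇒+∣i∣≡i (ℤP.i≤j⇒0≤j-i x≤y) = lemma x y
    where lemma : ∀ x y → x ℤ.+ (y ℤ.- x) ≡ y
          lemma = solve-∀

canonDy-<⇒⧏ : ∀ K {x y} → x ℤ.< y → canonDy x K ⧏ canonDy y K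
canonDy-<⇒⧏ K {x} {y} x<y y≲x = canonDy-⧏suc K x (≲-trans (canonDy-mono-≲ K x+1≤y) y≲x)
  where
  x+1≤y : x ℤ.+ + 1 ℤ.≤ y
  x+1≤y = subst (ℤ._≤ y) (ℤP.+-comm (+ 1) x) (ℤP.i<j⇒suc[i]≤j x<y)

canonDy-rightOption : ∀ K x {r} → r ∈ rightOpts (canonDy x K) → canonDy (x ℤ.+ + 1) K ≲ r
canonDy-rightOption zero (+ zero) ()
canonDy-rightOption zero (+ suc k) ()
canonDy-rightOption zero -[1+ zero ]  (here refl) = ≲-refl
canonDy-rightOption zero -[1+ suc k ] (here refl) = ≲-refl
canonDy-rightOption (suc K) x r∈ with parity x
... | even z rewrite canonDy-even z K | canonDy-odd z K =
  ≲-trans (≲-soleRightOption (canonDy-numberLike K (z ℤ.+ + 1)) (canonDy-⧏suc K z ∷ []))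
          (canonDy-rightOption K z r∈)
... | odd z rewrite z+z+1+1 z | canonDy-even (z ℤ.+ + 1) K | canonDy-odd z K with r∈
...   | here refl = ≲-refl

canonDy-zero : ∀ q → canonDy (+ 0) q ≡ ⟨ [] ∣ [] ⟩
canonDy-zero zero    = refl
canonDy-zero (suc q) = canonDy-zero q

pow₂ : ℕ → ℤ
pow₂ zero    = + 1
pow₂ (suc k) = + 2 ℤ.* pow₂ k

2^≡pow₂ : ∀ k → + (2 ^ k) ≡ pow₂ k
2^≡pow₂ zero    = refl
2^≡pow₂ (suc k) = trans (ℤP.pos-* 2 (2 ^ k)) (cong (+ 2 ℤ.*_) (2^≡pow₂ k))

pow₂-+ : ∀ a b → pow₂ (a + b) ≡ pow₂ a ℤ.* pow₂ b
pow₂-+ zero    b = sym (ℤP.*-identityˡ (pow₂ b))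
pow₂-+ (suc a) b = trans (cong (+ 2 ℤ.*_) (pow₂-+ a b)) (sym (ℤP.*-assoc (+ 2) (pow₂ a) (pow₂ b)))

pow₂-positive : ∀ k → ∃[ n ] pow₂ k ≡ + 1 ℤ.+ + n
pow₂-positive k with 2 ^ k | m^n>0 2 k | 2^≡pow₂ k
... | suc n | _ | eq = n , sym eq

≤-by-gap : ∀ {a b} d → a ℤ.+ + d ≡ b → a ℤ.≤ b
≤-by-gap {a} d a+d≡b = subst (a ℤ.≤_) a+d≡b (ℤP.i≤i+j a (+ d))

<-+pow₂ : ∀ x k → x ℤ.< x ℤ.+ pow₂ k
<-+pow₂ x k = ℤP.suc[i]≤j⇒i<j (≤-by-gap n (gap (proj₂ (pow₂-positive k))))
  where
  n = proj₁ (pow₂-positive k)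
  gap : ∀ {P} → P ≡ + 1 ℤ.+ + n → + 1 ℤ.+ x ℤ.+ + n ≡ x ℤ.+ P
  gap refl = identity x (+ n)
    where identity : ∀ x n → + 1 ℤ.+ x ℤ.+ n ≡ x ℤ.+ (+ 1 ℤ.+ n)
          identity = solve-∀

-pow₂-< : ∀ x k → x ℤ.- pow₂ k ℤ.< x
-pow₂-< x k = subst (x ℤ.- pow₂ k ℤ.<_) (identity x (pow₂ k)) (<-+pow₂ (x ℤ.- pow₂ k) k)
  where identity : ∀ x P → x ℤ.- P ℤ.+ P ≡ x
        identity = solve-∀

h+h+1-pow₂[1+E]<h+h : ∀ h E → h ℤ.+ h ℤ.+ + 1 ℤ.- pow₂ (suc E) ℤ.< h ℤ.+ h
h+h+1-pow₂[1+E]<h+h h E = ℤP.suc[i]≤j⇒i<j (≤-by-gap (n + n) (gap (proj₂ (pow₂-positive E))))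
  where
  n = proj₁ (pow₂-positive E)
  gap : ∀ {P} → P ≡ + 1 ℤ.+ + n → + 1 ℤ.+ (h ℤ.+ h ℤ.+ + 1 ℤ.- + 2 ℤ.* P) ℤ.+ + (n + n) ≡ h ℤ.+ h
  gap refl = identity h (+ n)
    where identity : ∀ h n → + 1 ℤ.+ (h ℤ.+ h ℤ.+ + 1 ℤ.- + 2 ℤ.* (+ 1 ℤ.+ n)) ℤ.+ (n ℤ.+ n) ≡ h ℤ.+ h
          identity = solve-∀

canonDy-rescale : ∀ j d e → canonDy (j ℤ.* pow₂ d) (d + e) ≡ canonDy j e
canonDy-rescale j zero    e = cong (λ i → canonDy i e) (ℤP.*-identityʳ j)
canonDy-rescale j (suc d) e = begin
  canonDy (j ℤ.* pow₂ (suc d)) (suc d + e)                  ≡⟨ cong (λ i → canonDy i (suc (d + e))) (lemma j (pow₂ d)) ⟩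
  canonDy (j ℤ.* pow₂ d ℤ.+ j ℤ.* pow₂ d) (suc (d + e))     ≡⟨ canonDy-even (j ℤ.* pow₂ d) (d + e) ⟩
  canonDy (j ℤ.* pow₂ d) (d + e)                            ≡⟨ canonDy-rescale j d e ⟩
  canonDy j e                                               ∎
  where
  open ≡-Reasoning
  lemma : ∀ j P → j ℤ.* (+ 2 ℤ.* P) ≡ j ℤ.* P ℤ.+ j ℤ.* P
  lemma = solve-∀

cut : ℤ → ℤ → ℕ → Game
cut u v K = ⟨ canonDy u K ∷ [] ∣ canonDy v K ∷ [] ⟩

halve-cut : ∀ z d L → cut (z ℤ.+ z ℤ.- + 2 ℤ.* d) (z ℤ.+ z ℤ.+ + 2 ℤ.* d) (suc L) ≡ cut (z ℤ.- d) (z ℤ.+ d) L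
halve-cut z d L = cong₂ (λ U V → ⟨ U ∷ [] ∣ V ∷ [] ⟩)
  (trans (cong (λ i → canonDy i (suc L)) (lower z d)) (canonDy-even (z ℤ.- d) L))
  (trans (cong (λ i → canonDy i (suc L)) (upper z d)) (canonDy-even (z ℤ.+ d) L))
  where
  lower : ∀ z d → z ℤ.+ z ℤ.- + 2 ℤ.* d ≡ (z ℤ.- d) ℤ.+ (z ℤ.- d)
  lower = solve-∀
  upper : ∀ z d → z ℤ.+ z ℤ.+ + 2 ℤ.* d ≡ (z ℤ.+ d) ℤ.+ (z ℤ.+ d)
  upper = solve-∀

cut-rescale : ∀ N E p → cut (N ℤ.* pow₂ E ℤ.- pow₂ E) (N ℤ.* pow₂ E ℤ.+ pow₂ E) (E + p) ≡ cut (N ℤ.- + 1) (N ℤ.+ + 1) p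
cut-rescale N E p = cong₂ (λ U V → ⟨ U ∷ [] ∣ V ∷ [] ⟩)
  (trans (cong (λ i → canonDy i (E + p)) (lower N (pow₂ E))) (canonDy-rescale (N ℤ.- + 1) E p))
  (trans (cong (λ i → canonDy i (E + p)) (upper N (pow₂ E))) (canonDy-rescale (N ℤ.+ + 1) E p))
  where
  lower : ∀ N P → N ℤ.* P ℤ.- P ≡ (N ℤ.- + 1) ℤ.* P
  lower = solve-∀
  upper : ∀ N P → N ℤ.* P ℤ.+ P ≡ (N ℤ.+ + 1) ℤ.* P
  upper = solve-∀

balanced-cut⇒≃ : ∀ K {u x v} → u ℤ.< x → x ℤ.< v →
  cut u v K ⊕ cut u v K ≃ canonDy x K ⊕ canonDy x K → cut u v K ≃ canonDy x K
balanced-cut⇒≃ K u<x x<v = balanced⇒≃ (canonDy-numberLike K _)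
  (λ { (here refl) → canonDy-<⇒⧏ K u<x }) (λ { (here refl) → canonDy-<⇒⧏ K x<v })

-- An odd centre (2h+1)/2^(1+E+K) has the left option h/2^(E+K), which still lies inside the ball;
-- the ball is then ≲ that option, which is impossible for a game equal to the centre.
centre-divisible : ∀ E K x → canonDy x (E + K) ≃ cut (x ℤ.- pow₂ E) (x ℤ.+ pow₂ E) (E + K) →
                   ∃[ z ] x ≡ z ℤ.* pow₂ E
centre-divisible zero K x _ = x , sym (ℤP.*-identityʳ x)
centre-divisible (suc E) K x x≃B with parity x
... | even z = w , (begin
      z ℤ.+ z                          ≡⟨ cong₂ ℤ._+_ z≡w2ᴱ z≡w2ᴱ ⟩
      w ℤ.* pow₂ E ℤ.+ w ℤ.* pow₂ E    ≡⟨ lemma w (pow₂ E) ⟩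
      w ℤ.* pow₂ (suc E)               ∎)
  where
  open ≡-Reasoning
  lemma : ∀ w P → w ℤ.* P ℤ.+ w ℤ.* P ≡ w ℤ.* (+ 2 ℤ.* P)
  lemma = solve-∀
  z≃cut : canonDy z (E + K) ≃ cut (z ℤ.- pow₂ E) (z ℤ.+ pow₂ E) (E + K)
  z≃cut = subst₂ _≃_ (canonDy-even z (E + K))
            (halve-cut z (pow₂ E) (E + K))
            x≃B
  IH = centre-divisible E K z z≃cut
  w = proj₁ IH
  z≡w2ᴱ = proj₂ IH
... | odd h rewrite canonDy-odd h (E + K) = ⊥-elim (leftOption⧏ (here refl) (≲-trans (proj₁ x≃B) cut≲h))
  where
  cut≲h : cut (h ℤ.+ h ℤ.+ + 1 ℤ.- pow₂ (suc E)) (h ℤ.+ h ℤ.+ + 1 ℤ.+ pow₂ (suc E)) (suc (E + K)) ≲ canonDy h (E + K)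
  cut≲h = ≲-intro
    (λ { (here refl) → subst (canonDy (h ℤ.+ h ℤ.+ + 1 ℤ.- pow₂ (suc E)) (suc (E + K)) ⧏_)
                               (canonDy-even h (E + K)) (canonDy-<⇒⧏ (suc (E + K)) (h+h+1-pow₂[1+E]<h+h h E)) })
    (λ r∈ r≲B → ⧏rightOption (here refl)
       (≲-trans (canonDy-rightOption (E + K) h r∈) (≲-trans r≲B (proj₂ x≃B))))

ball-as-cut : ∀ J E p → ball (dy J E) (-ᵈ inv2^ p) ≡ cut (J ℤ.* pow₂ p ℤ.- pow₂ E) (J ℤ.* pow₂ p ℤ.+ pow₂ E) (E + p)
ball-as-cut J E p = cong₂ (λ u v → cut u v (E + p)) (lower (2^≡pow₂ p) (2^≡pow₂ E)) (upper (2^≡pow₂ p) (2^≡pow₂ E))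
  where
  lower : ∀ {X Y} → X ≡ pow₂ p → Y ≡ pow₂ E → J ℤ.* X ℤ.+ ℤ.- + 1 ℤ.* Y ≡ J ℤ.* pow₂ p ℤ.- pow₂ E
  lower refl refl = identity J (pow₂ p) (pow₂ E)
    where identity : ∀ J Pp PE → J ℤ.* Pp ℤ.+ ℤ.- + 1 ℤ.* PE ≡ J ℤ.* Pp ℤ.- PE
          identity = solve-∀
  upper : ∀ {X Y} → X ≡ pow₂ p → Y ≡ pow₂ E → J ℤ.* X ℤ.+ ℤ.- (ℤ.- + 1) ℤ.* Y ≡ J ℤ.* pow₂ p ℤ.+ pow₂ E
  upper refl refl = identity J (pow₂ p) (pow₂ E)
    where identity : ∀ J Pp PE → J ℤ.* Pp ℤ.+ ℤ.- (ℤ.- + 1) ℤ.* PE ≡ J ℤ.* Pp ℤ.+ PE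
          identity = solve-∀

balanced-ball : ∀ J E p → Balanced (dy J E) (-ᵈ inv2^ p) →
  ∃[ N ] J ℤ.* pow₂ p ≡ N ℤ.* pow₂ E
       × ball (dy J E) (-ᵈ inv2^ p) ≡ cut (N ℤ.- + 1) (N ℤ.+ + 1) p
       × cut (N ℤ.- + 1) (N ℤ.+ + 1) p ≃ canonDy N p
balanced-ball J E p balanced = N , x≡NPE , trans (ball-as-cut J E p) cut≡cut₀ ,
  subst₂ _≃_ cut≡cut₀ (trans (cong (λ y → canonDy y (E + p)) x≡NPE) (canonDy-rescale N E p)) cut≃x
  where
  x = J ℤ.* pow₂ p
  centre : canonDy J E ≡ canonDy x (E + p)
  centre = sym (trans (cong (canonDy x) (+-comm E p)) (canonDy-rescale J p E))
  cut≃x : cut (x ℤ.- pow₂ E) (x ℤ.+ pow₂ E) (E + p) ≃ canonDy x (E + p)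
  cut≃x = balanced-cut⇒≃ (E + p) (-pow₂-< x E) (<-+pow₂ x E)
            (subst₂ (λ B C → B ⊕ B ≃ C ⊕ C) (ball-as-cut J E p) centre (≈⇒≃ balanced))
  divisible = centre-divisible E p x (≃-sym cut≃x)
  N = proj₁ divisible
  x≡NPE = proj₂ divisible
  cut≡cut₀ : cut (x ℤ.- pow₂ E) (x ℤ.+ pow₂ E) (E + p) ≡ cut (N ℤ.- + 1) (N ℤ.+ + 1) p
  cut≡cut₀ = trans (cong (λ y → cut (y ℤ.- pow₂ E) (y ℤ.+ pow₂ E) (E + p)) x≡NPE) (cut-rescale N E p)

half-< : ∀ {k n} → k + k < 2 * n → k < n
half-< {k} {n} k+k<2n = ≰⇒> λ n≤k → <⇒≱ k+k<2n (subst (ℕ._≤ k + k) (cong (λ x → n + x) (sym (+-identityʳ n))) (+-mono-≤ n≤k n≤k))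

data Parityℕ : ℕ → Set where
  even : ∀ k → Parityℕ (k + k)
  odd  : ∀ k → Parityℕ (suc (k + k))

parityℕ : ∀ n → Parityℕ n
parityℕ zero = even 0
parityℕ (suc n) with parityℕ n
... | even k = odd k
... | odd k  = subst Parityℕ (cong suc (+-suc k k)) (even (suc k))

-- B₀ is the ball [N/2^p, -1/2^p].
module OrdinalSumOfBall (N : ℤ) (p : ℕ) (ball≃centre : cut (N ℤ.- + 1) (N ℤ.+ + 1) p ≃ canonDy N p) where

  B₀ : Game
  B₀ = cut (N ℤ.- + 1) (N ℤ.+ + 1) p

  -- approach m / 2^(m+p) = (N+1)/2^p - 1/2^(p+m) is the value of B₀ ∶ m.
  approach : ℕ → ℤ
  approach zero    = N
  approach (suc m) = approach m ℤ.+ approach m ℤ.+ + 1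

  approach+1 : ∀ m → approach m ℤ.+ + 1 ≡ (N ℤ.+ + 1) ℤ.* pow₂ m
  approach+1 zero    = sym (ℤP.*-identityʳ (N ℤ.+ + 1))
  approach+1 (suc m) = begin
    approach m ℤ.+ approach m ℤ.+ + 1 ℤ.+ + 1          ≡⟨ z+z+1+1 (approach m) ⟩
    (approach m ℤ.+ + 1) ℤ.+ (approach m ℤ.+ + 1)      ≡⟨ cong₂ ℤ._+_ (approach+1 m) (approach+1 m) ⟩
    (N ℤ.+ + 1) ℤ.* pow₂ m ℤ.+ (N ℤ.+ + 1) ℤ.* pow₂ m  ≡⟨ lemma (N ℤ.+ + 1) (pow₂ m) ⟩
    (N ℤ.+ + 1) ℤ.* pow₂ (suc m)                       ∎
    where
    open ≡-Reasoning
    lemma : ∀ a P → a ℤ.* P ℤ.+ a ℤ.* P ≡ a ℤ.* (+ 2 ℤ.* P)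
    lemma = solve-∀

  rightOption-approach : ∀ m → canonDy (approach m ℤ.+ + 1) (m + p) ≡ canonDy (N ℤ.+ + 1) p
  rightOption-approach m = trans (cong (λ i → canonDy i (m + p)) (approach+1 m)) (canonDy-rescale (N ℤ.+ + 1) m p)

  leftOfBall-≲ : ∀ c q → canonDy (N ℤ.- + 1) p ≲ B₀ ∶ canonDy (+ c) q
  leftOfBall-≲ c q = begin
    canonDy (N ℤ.- + 1) p      ≲⟨ canonDy-mono-≲ p (ℤP.i-j≤i N (+ 1)) ⟩
    canonDy N p                ≲⟨ proj₂ ball≃centre ⟩
    B₀ ∶ ⟨ [] ∣ [] ⟩           ≲⟨ ∶-monoʳ-≲ B₀ (subst (_≲ canonDy (+ c) q) (canonDy-zero q) (canonDy-mono-≲ q (ℤ.+≤+ ℕ.z≤n))) ⟩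
    B₀ ∶ canonDy (+ c) q       ∎
    where open ≲-Reasoning

  colon-nat : ∀ m → B₀ ∶ natGame m ≃ canonDy (approach m) (m + p)
  colon-nat zero    = ball≃centre
  colon-nat (suc m) = ≃-trans
    (≃-extremalOptions (≲-trans (leftOfBall-≲ m 0) (proj₁ IH) ∷ proj₁ IH ∷ []) (there (here (proj₂ IH)))
                       (≲-reflexive (rightOption-approach m) ∷ []) (here (≲-reflexive (sym (rightOption-approach m)))))
    (≃-reflexive (sym (canonDy-odd (approach m) (m + p))))
    where IH = colon-nat m

  colon-cut : ∀ c q t K →
    B₀ ∶ canonDy (+ c) q ≃ canonDy t K →
    B₀ ∶ canonDy (+ c ℤ.+ + 1) q ≃ canonDy (t ℤ.+ + 1) K →
    canonDy (t ℤ.+ + 1) K ≲ canonDy (N ℤ.+ + 1) p →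
    B₀ ∶ cut (+ c) (+ c ℤ.+ + 1) q ≃ cut t (t ℤ.+ + 1) K
  colon-cut c q t K left≃ right≃ right≲ = ≃-extremalOptions
    (≲-trans (leftOfBall-≲ c q) (proj₁ left≃) ∷ proj₁ left≃ ∷ []) (there (here (proj₂ left≃)))
    (right≲ ∷ proj₂ right≃ ∷ []) (there (here (proj₁ right≃)))

  numerator : ℕ → ℕ → ℕ → ℤ
  numerator m q a = + a ℤ.+ approach m ℤ.* pow₂ (suc q)

  level : ℕ → ℕ → ℕ
  level m q = suc q + (m + p)

  ColonFormula : ℕ → Set
  ColonFormula q = ∀ m a → a < 2 ^ q →
    B₀ ∶ canonDy (+ (m * 2 ^ q + a)) q ≃ canonDy (numerator m q a) (level m q)

  numerator-zero : ∀ m → numerator m 0 0 ≡ approach m ℤ.+ approach m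
  numerator-zero m = lemma (approach m)
    where lemma : ∀ h → + 0 ℤ.+ h ℤ.* + 2 ≡ h ℤ.+ h
          lemma = solve-∀

  numerator-even : ∀ m q k → numerator m (suc q) (k + k) ≡ numerator m q k ℤ.+ numerator m q k
  numerator-even m q k = lemma (+ k) (approach m) (pow₂ (suc q))
    where lemma : ∀ a h P → a ℤ.+ a ℤ.+ h ℤ.* (+ 2 ℤ.* P) ≡ (a ℤ.+ h ℤ.* P) ℤ.+ (a ℤ.+ h ℤ.* P)
          lemma = solve-∀

  numerator-odd : ∀ m q k → numerator m (suc q) (suc (k + k)) ≡ numerator m q k ℤ.+ numerator m q k ℤ.+ + 1
  numerator-odd m q k = lemma (+ k) (approach m) (pow₂ (suc q))
    where lemma : ∀ a h P → + 1 ℤ.+ (a ℤ.+ a) ℤ.+ h ℤ.* (+ 2 ℤ.* P) ≡ (a ℤ.+ h ℤ.* P) ℤ.+ (a ℤ.+ h ℤ.* P) ℤ.+ + 1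
          lemma = solve-∀

  numerator-suc : ∀ m q a → numerator m q (suc a) ≡ numerator m q a ℤ.+ + 1
  numerator-suc m q a = lemma (+ a) (approach m ℤ.* pow₂ (suc q))
    where lemma : ∀ a X → + 1 ℤ.+ a ℤ.+ X ≡ a ℤ.+ X ℤ.+ + 1
          lemma = solve-∀

  numerator-carry : ∀ m q a → + 1 ℤ.+ + a ≡ pow₂ q →
    numerator (suc m) q 0 ≡ (numerator m q a ℤ.+ + 1) ℤ.+ (numerator m q a ℤ.+ + 1)
  numerator-carry m q a = carry (+ a) (approach m)
    where
    carry : ∀ a h {P} → + 1 ℤ.+ a ≡ P →
            + 0 ℤ.+ (h ℤ.+ h ℤ.+ + 1) ℤ.* (+ 2 ℤ.* P) ≡ (a ℤ.+ h ℤ.* (+ 2 ℤ.* P) ℤ.+ + 1) ℤ.+ (a ℤ.+ h ℤ.* (+ 2 ℤ.* P) ℤ.+ + 1)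
    carry a h refl = lemma a h
      where lemma : ∀ a h → + 0 ℤ.+ (h ℤ.+ h ℤ.+ + 1) ℤ.* (+ 2 ℤ.* (+ 1 ℤ.+ a))
                          ≡ (a ℤ.+ h ℤ.* (+ 2 ℤ.* (+ 1 ℤ.+ a)) ℤ.+ + 1) ℤ.+ (a ℤ.+ h ℤ.* (+ 2 ℤ.* (+ 1 ℤ.+ a)) ℤ.+ + 1)
            lemma = solve-∀

  numerator-below : ∀ m q a → a < 2 ^ q → numerator m q a ℤ.+ + 1 ℤ.≤ (approach m ℤ.+ + 1) ℤ.* pow₂ (suc q)
  numerator-below m q a a<2^q = begin
    numerator m q a ℤ.+ + 1                ≡⟨ numerator-suc m q a ⟨
    numerator m q (suc a)                  ≤⟨ ℤP.+-monoˡ-≤ (approach m ℤ.* pow₂ (suc q)) (ℤ.+≤+ 1+a≤2^[1+q]) ⟩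
    numerator m q (2 ^ suc q)              ≡⟨ cong (λ P → P ℤ.+ approach m ℤ.* pow₂ (suc q)) (2^≡pow₂ (suc q)) ⟩
    pow₂ (suc q) ℤ.+ approach m ℤ.* pow₂ (suc q) ≡⟨ lemma (approach m) (pow₂ (suc q)) ⟩
    (approach m ℤ.+ + 1) ℤ.* pow₂ (suc q)  ∎
    where
    open ℤP.≤-Reasoning
    1+a≤2^[1+q] : suc a ℕ.≤ 2 ^ suc q
    1+a≤2^[1+q] = ≤-trans a<2^q (m≤m+n (2 ^ q) (2 ^ q + 0))
    lemma : ∀ h P → P ℤ.+ h ℤ.* P ≡ (h ℤ.+ + 1) ℤ.* P
    lemma = solve-∀

  colon-successor : ∀ {q} → ColonFormula q → ∀ m k → k < 2 ^ q →
    B₀ ∶ canonDy (+ (m * 2 ^ q + k) ℤ.+ + 1) q ≃ canonDy (numerator m q k ℤ.+ + 1) (level m q)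
  colon-successor {q} IH m k k<2^q with m≤n⇒m<n∨m≡n k<2^q
  ... | inj₁ 1+k<2^q = begin
    B₀ ∶ canonDy (+ (m * 2 ^ q + k + 1)) q       ≡⟨ cong (λ c → B₀ ∶ canonDy (+ c) q) (lemma (m * 2 ^ q) k) ⟩
    B₀ ∶ canonDy (+ (m * 2 ^ q + suc k)) q       ≈⟨ IH m (suc k) 1+k<2^q ⟩
    canonDy (numerator m q (suc k)) (level m q)  ≡⟨ cong (λ i → canonDy i (level m q)) (numerator-suc m q k) ⟩
    canonDy (numerator m q k ℤ.+ + 1) (level m q) ∎
    where
    open ≃-Reasoning
    lemma : ∀ x k → x + k + 1 ≡ x + suc k
    lemma = ℕ-Solver.solve-∀
  ... | inj₂ 1+k≡2^q = begin
    B₀ ∶ canonDy (+ (m * 2 ^ q + k + 1)) q       ≡⟨ cong (λ c → B₀ ∶ canonDy (+ c) q) (lemma m (2 ^ q) k 1+k≡2^q) ⟩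
    B₀ ∶ canonDy (+ (suc m * 2 ^ q + 0)) q       ≈⟨ IH (suc m) 0 (m^n>0 2 q) ⟩
    canonDy (numerator (suc m) q 0) (level (suc m) q)
      ≡⟨ cong₂ canonDy (numerator-carry m q k (trans (cong +_ 1+k≡2^q) (2^≡pow₂ q))) (+-suc (suc q) (m + p)) ⟩
    canonDy (t ℤ.+ t) (suc (level m q))          ≡⟨ canonDy-even t (level m q) ⟩
    canonDy t (level m q)                        ∎
    where
    open ≃-Reasoning
    t = numerator m q k ℤ.+ + 1
    lemma : ∀ m Q k → suc k ≡ Q → m * Q + k + 1 ≡ suc m * Q + 0
    lemma m _ k refl = identity m k
      where identity : ∀ m k → m * suc k + k + 1 ≡ suc m * suc k + 0
            identity = ℕ-Solver.solve-∀

  successor-≲-rightOfBall : ∀ m q a → a < 2 ^ q →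
    canonDy (numerator m q a ℤ.+ + 1) (level m q) ≲ canonDy (N ℤ.+ + 1) p
  successor-≲-rightOfBall m q a a<2^q = begin
    canonDy (numerator m q a ℤ.+ + 1) (level m q)                    ≲⟨ canonDy-mono-≲ (level m q) (numerator-below m q a a<2^q) ⟩
    canonDy ((approach m ℤ.+ + 1) ℤ.* pow₂ (suc q)) (suc q + (m + p)) ≡⟨ canonDy-rescale (approach m ℤ.+ + 1) (suc q) (m + p) ⟩
    canonDy (approach m ℤ.+ + 1) (m + p)                              ≡⟨ rightOption-approach m ⟩
    canonDy (N ℤ.+ + 1) p                                             ∎
    where open ≲-Reasoning

  colon-integer : ColonFormula 0
  colon-integer m zero _ = begin
    B₀ ∶ natGame (m * 1 + 0)                             ≡⟨ cong (λ c → B₀ ∶ natGame c) (lemma m) ⟩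
    B₀ ∶ natGame m                                       ≈⟨ colon-nat m ⟩
    canonDy (approach m) (m + p)                         ≡⟨ canonDy-even (approach m) (m + p) ⟨
    canonDy (approach m ℤ.+ approach m) (level m 0)      ≡⟨ cong (λ i → canonDy i (level m 0)) (numerator-zero m) ⟨
    canonDy (numerator m 0 0) (level m 0)                ∎
    where
    open ≃-Reasoning
    lemma : ∀ m → m * 1 + 0 ≡ m
    lemma = ℕ-Solver.solve-∀
  colon-integer m (suc a) (ℕ.s≤s ())

  colon-even : ∀ {q} → ColonFormula q → ∀ m k → k < 2 ^ q →
    B₀ ∶ canonDy (+ (m * 2 ^ suc q + (k + k))) (suc q) ≃ canonDy (numerator m (suc q) (k + k)) (level m (suc q))
  colon-even {q} IH m k k<2^q = begin
    B₀ ∶ canonDy (+ (m * 2 ^ suc q + (k + k))) (suc q)   ≡⟨ cong (λ c → B₀ ∶ canonDy (+ c) (suc q)) (lemma m (2 ^ q) k) ⟩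
    B₀ ∶ canonDy (+ c ℤ.+ + c) (suc q)                   ≡⟨ cong (B₀ ∶_) (canonDy-even (+ c) q) ⟩
    B₀ ∶ canonDy (+ c) q                                 ≈⟨ IH m k k<2^q ⟩
    canonDy t (level m q)                                ≡⟨ canonDy-even t (level m q) ⟨
    canonDy (t ℤ.+ t) (level m (suc q))                  ≡⟨ cong (λ i → canonDy i (level m (suc q))) (numerator-even m q k) ⟨
    canonDy (numerator m (suc q) (k + k)) (level m (suc q)) ∎
    where
    open ≃-Reasoning
    c = m * 2 ^ q + k
    t = numerator m q k
    lemma : ∀ m Q k → m * (2 * Q) + (k + k) ≡ (m * Q + k) + (m * Q + k)
    lemma = ℕ-Solver.solve-∀

  colon-odd : ∀ {q} → ColonFormula q → ∀ m k → k < 2 ^ q →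
    B₀ ∶ canonDy (+ (m * 2 ^ suc q + suc (k + k))) (suc q) ≃ canonDy (numerator m (suc q) (suc (k + k))) (level m (suc q))
  colon-odd {q} IH m k k<2^q = begin
    B₀ ∶ canonDy (+ (m * 2 ^ suc q + suc (k + k))) (suc q)   ≡⟨ cong (λ c → B₀ ∶ canonDy (+ c) (suc q)) (lemma m (2 ^ q) k) ⟩
    B₀ ∶ canonDy (+ c ℤ.+ + c ℤ.+ + 1) (suc q)               ≡⟨ cong (B₀ ∶_) (canonDy-odd (+ c) q) ⟩
    B₀ ∶ cut (+ c) (+ c ℤ.+ + 1) q                           ≈⟨ colon-cut c q t (level m q) (IH m k k<2^q)
                                                                   (colon-successor {q} IH m k k<2^q)
                                                                   (successor-≲-rightOfBall m q k k<2^q) ⟩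
    cut t (t ℤ.+ + 1) (level m q)                            ≡⟨ canonDy-odd t (level m q) ⟨
    canonDy (t ℤ.+ t ℤ.+ + 1) (level m (suc q))              ≡⟨ cong (λ i → canonDy i (level m (suc q))) (numerator-odd m q k) ⟨
    canonDy (numerator m (suc q) (suc (k + k))) (level m (suc q)) ∎
    where
    open ≃-Reasoning
    c = m * 2 ^ q + k
    t = numerator m q k
    lemma : ∀ m Q k → m * (2 * Q) + suc (k + k) ≡ (m * Q + k) + (m * Q + k) + 1
    lemma = ℕ-Solver.solve-∀

  colon-canonical : ∀ q → ColonFormula q
  colon-canonical zero = colon-integer
  colon-canonical (suc q) m a a<2^[1+q] with parityℕ a
  ... | even k = colon-even (colon-canonical q) m k (half-< a<2^[1+q])
  ... | odd k  = colon-odd (colon-canonical q) m k (half-< (<-trans (n<1+n (k + k)) a<2^[1+q]))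

  approach-closed : ∀ m → approach m ≡ (N ℤ.+ + 1) ℤ.* pow₂ m ℤ.- + 1
  approach-closed m = trans (lemma (approach m)) (cong (ℤ._- + 1) (approach+1 m))
    where lemma : ∀ h → h ≡ h ℤ.+ + 1 ℤ.- + 1
          lemma = solve-∀

-- The left-hand side is the numerator that _+ᵈ_ computes for the right-hand side of theorem4p5.
frozen-numerator : ∀ J N a E p m q → J ℤ.* pow₂ p ≡ N ℤ.* pow₂ E →
  ((J ℤ.* + (2 ^ p) ℤ.+ + 1 ℤ.* + (2 ^ E)) ℤ.* + (2 ^ (p + m)) ℤ.+ ℤ.- + 1 ℤ.* + (2 ^ (E + p))) ℤ.* + (2 ^ (p + m + q + 1))
    ℤ.+ + a ℤ.* + (2 ^ (E + p + (p + m)))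
  ≡ (+ a ℤ.+ ((N ℤ.+ + 1) ℤ.* pow₂ m ℤ.- + 1) ℤ.* pow₂ (suc q)) ℤ.* pow₂ (E + p + p + m)
frozen-numerator J N a E p m q JPp≡NPE = identity
  (trans (cong (J ℤ.*_) (2^≡pow₂ p)) JPp≡NPE)
  (2^≡pow₂ E)
  (trans (2^≡pow₂ (p + m)) (pow₂-+ p m))
  (trans (2^≡pow₂ (E + p)) (pow₂-+ E p))
  (trans (2^≡pow₂ (p + m + q + 1)) (trans (pow₂-+ (p + m + q) 1) (cong (ℤ._* + 2) (trans (pow₂-+ (p + m) q) (cong (ℤ._* pow₂ q) (pow₂-+ p m))))))
  (trans (2^≡pow₂ (E + p + (p + m))) (trans (pow₂-+ (E + p) (p + m)) (cong₂ ℤ._*_ (pow₂-+ E p) (pow₂-+ p m))))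
  (trans (pow₂-+ (E + p + p) m) (cong (ℤ._* pow₂ m) (trans (pow₂-+ (E + p) p) (cong (ℤ._* pow₂ p) (pow₂-+ E p)))))
  where
  identity : ∀ {x X₂ X₃ X₄ X₅ X₆ Y} → x ≡ N ℤ.* pow₂ E → X₂ ≡ pow₂ E → X₃ ≡ pow₂ p ℤ.* pow₂ m → X₄ ≡ pow₂ E ℤ.* pow₂ p →
    X₅ ≡ pow₂ p ℤ.* pow₂ m ℤ.* pow₂ q ℤ.* + 2 → X₆ ≡ pow₂ E ℤ.* pow₂ p ℤ.* (pow₂ p ℤ.* pow₂ m) →
    Y ≡ pow₂ E ℤ.* pow₂ p ℤ.* pow₂ p ℤ.* pow₂ m →
    ((x ℤ.+ + 1 ℤ.* X₂) ℤ.* X₃ ℤ.+ ℤ.- + 1 ℤ.* X₄) ℤ.* X₅ ℤ.+ + a ℤ.* X₆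
      ≡ (+ a ℤ.+ ((N ℤ.+ + 1) ℤ.* pow₂ m ℤ.- + 1) ℤ.* pow₂ (suc q)) ℤ.* Y
  identity refl refl refl refl refl refl refl = ring N (+ a) (pow₂ E) (pow₂ p) (pow₂ m) (pow₂ q)
    where
    ring : ∀ N a PE Pp Pm Pq →
      ((N ℤ.* PE ℤ.+ + 1 ℤ.* PE) ℤ.* (Pp ℤ.* Pm) ℤ.+ ℤ.- + 1 ℤ.* (PE ℤ.* Pp)) ℤ.* (Pp ℤ.* Pm ℤ.* Pq ℤ.* + 2)
        ℤ.+ a ℤ.* (PE ℤ.* Pp ℤ.* (Pp ℤ.* Pm))
      ≡ (a ℤ.+ ((N ℤ.+ + 1) ℤ.* Pm ℤ.- + 1) ℤ.* (+ 2 ℤ.* Pq)) ℤ.* (PE ℤ.* Pp ℤ.* Pp ℤ.* Pm)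
    ring = solve-∀

target-value : ∀ J E N p m q a → J ℤ.* pow₂ p ≡ N ℤ.* pow₂ E →
  canonDy (+ a ℤ.+ ((N ℤ.+ + 1) ℤ.* pow₂ m ℤ.- + 1) ℤ.* pow₂ (suc q)) (suc q + (m + p))
  ≡ canon (dy J E +ᵈ inv2^ p -ᵈ inv2^ (p + m) +ᵈ dy (+ a) (p + m + q + 1))
target-value J E N p m q a JPp≡NPE = trans
  (sym (canonDy-rescale (+ a ℤ.+ ((N ℤ.+ + 1) ℤ.* pow₂ m ℤ.- + 1) ℤ.* pow₂ (suc q)) (E + p + p + m) (suc q + (m + p))))
  (cong₂ canonDy (sym (frozen-numerator J N a E p m q JPp≡NPE)) (exponent E p m q))
  where
  exponent : ∀ E p m q → E + p + p + m + (suc q + (m + p)) ≡ E + p + (p + m) + (p + m + q + 1)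
  exponent = ℕ-Solver.solve-∀

odd-or-zero⇒<2^q : ∀ q {a} → ((a % 2 ≡ 1) × (0 < a) × (a < 2 ^ q)) ⊎ (a ≡ 0) → a < 2 ^ q
odd-or-zero⇒<2^q q (inj₁ (_ , _ , a<2^q)) = a<2^q
odd-or-zero⇒<2^q q (inj₂ refl)            = m^n>0 2 q

theorem4p5 : (n : Dyadic) (p : ℕ) → Balanced n (-ᵈ inv2^ p) →
    (m q a : ℕ) →
    (((a % 2 ≡ 1) × (0 < a) × (a < 2 ^ q)) ⊎ (a ≡ 0)) →
    0 < m * 2 ^ q + a →
    (H : Game) → H ≈ canon (dy (+ (m * 2 ^ q + a)) q) →
    ball n (-ᵈ inv2^ p) ∶ H ≈
      canon (n +ᵈ inv2^ p -ᵈ inv2^ (p + m) +ᵈ dy (+ a) (p + m + q + 1))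
theorem4p5 (dy J E) p balanced m q a a-range _ H H≈C = ≃⇒≈ (begin
  ball (dy J E) (-ᵈ inv2^ p) ∶ H                      ≡⟨ cong (_∶ H) ball≡B₀ ⟩
  B₀ ∶ H                                              ≈⟨ ∶-congʳ B₀ (≈⇒≃ H≈C) ⟩
  B₀ ∶ canonDy (+ (m * 2 ^ q + a)) q                  ≈⟨ colon-canonical q m a (odd-or-zero⇒<2^q q a-range) ⟩
  canonDy (numerator m q a) (level m q)               ≡⟨ cong (λ h → canonDy (+ a ℤ.+ h ℤ.* pow₂ (suc q)) (level m q)) (approach-closed m) ⟩
  canonDy (+ a ℤ.+ ((N ℤ.+ + 1) ℤ.* pow₂ m ℤ.- + 1) ℤ.* pow₂ (suc q)) (level m q)
                                                      ≡⟨ target-value J E N p m q a JPp≡NPE ⟩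
  canon (dy J E +ᵈ inv2^ p -ᵈ inv2^ (p + m) +ᵈ dy (+ a) (p + m + q + 1)) ∎)
  where
  centred = balanced-ball J E p balanced
  N = proj₁ centred
  JPp≡NPE = proj₁ (proj₂ centred)
  ball≡B₀ = proj₁ (proj₂ (proj₂ centred))
  B₀≃N = proj₂ (proj₂ (proj₂ centred))
  open OrdinalSumOfBall N p B₀≃N
  open ≃-Reasoning
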